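{- As formal power series in $z$ and $y$, \[ \sum_{p\geq0}\sum_{n\geq p}\mathbb{B}_{n}^{(-p)}\frac{z^{n}}{n!}\frac{y^{p}}{p!}=\exp\!\big((y+1)(e^{z}-1)\big). \]
   Context: For an integer $p\ge0$, the poly-Bell numbers $\mathbb{B}_{n}^{(-p)}$ ($n\ge0$) are defined by $\sum_{n\geq0}\mathbb{B}_{n}^{(-p)}\frac{z^{n}}{n!}=\sum_{k\geq p}\frac{(e^{z}-1)^{k}}{(k-p)!}$. -}

module Defs where

open import Data.Nat using (ℕ; zero; suc; _∸_; _≤ᵇ_; _!)
open import Data.Nat.Properties using (_!≢0)
open import Data.Integer using (+_)
open import Data.Rational using (ℚ; 0ℚ; 1ℚ; _+_; _*_; _/_)
open import Data.Bool using (if_then_else_)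

invFact : ℕ → ℚ
invFact n = (+ 1) / (n !)
  where instance _ = n !≢0

fact : ℕ → ℚ
fact n = (+ (n !)) / 1

Σ≤ : ℕ → (ℕ → ℚ) → ℚ
Σ≤ zero    f = f 0
Σ≤ (suc n) f = Σ≤ n f + f (suc n)

-- Formal power series in one variable z over ℚ: coefficient of z^n.

PS : Set
PS = ℕ → ℚ

onePS : PS
onePS zero    = 1ℚ
onePS (suc _) = 0ℚ

_*PS_ : PS → PS → PS
(f *PS g) n = Σ≤ n (λ i → f i * g (n ∸ i))

powPS : PS → ℕ → PS
powPS f zero    = onePS
powPS f (suc k) = f *PS powPS f k

scalePS : ℚ → PS → PS
scalePS c f n = c * f n

expm1 : PS
expm1 zero    = 0ℚ
expm1 (suc n) = invFact (suc n)

-- Sum of a family (F k)_{k ≥ 0} where F k has z-order ≥ k (locally finite):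
-- the coefficient of z^n only involves k ≤ n.
ΣOrd : (ℕ → PS) → PS
ΣOrd F n = Σ≤ n (λ k → F k n)

polyBellEGF : ℕ → PS
polyBellEGF p = ΣOrd (λ k → if p ≤ᵇ k then scalePS (invFact (k ∸ p)) (powPS expm1 k)
                                       else (λ _ → 0ℚ))

-- poly-Bell number 𝔹_n^{(-p)} = n! [z^n] Σ_{k ≥ p} (e^z - 1)^k / (k - p)!
polyBell : ℕ → ℕ → ℚ
polyBell n p = fact n * polyBellEGF p n

-- Formal power series in two variables z, y over ℚ:
-- F n p = coefficient of z^n y^p.

PS2 : Set
PS2 = ℕ → ℕ → ℚ

one2 : PS2
one2 zero zero = 1ℚ
one2 _    _    = 0ℚ

_*2_ : PS2 → PS2 → PS2
(f *2 g) n p = Σ≤ n (λ i → Σ≤ p (λ j → f i j * g (n ∸ i) (p ∸ j)))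

pow2 : PS2 → ℕ → PS2
pow2 f zero    = one2
pow2 f (suc k) = f *2 pow2 f k

-- exp(A) = Σ_{m ≥ 0} A^m / m!  for A with zero constant term;
-- A^m has total degree ≥ m, so the coefficient of z^n y^p involves m ≤ n + p.
exp2 : PS2 → PS2
exp2 A n p = Σ≤ (n Data.Nat.+ p) (λ m → invFact m * pow2 A m n p)

yPlus1 : PS2
yPlus1 zero zero          = 1ℚ
yPlus1 zero (suc zero)    = 1ℚ
yPlus1 _    _             = 0ℚ

expm1₂ : PS2
expm1₂ n zero    = expm1 n
expm1₂ n (suc _) = 0ℚ

lhsSeries : PS2
lhsSeries n p = if p ≤ᵇ n then polyBell n p * invFact n * invFact p else 0ℚ

rhsSeries : PS2
rhsSeries = exp2 (yPlus1 *2 expm1₂)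

module Submission where

-- Write E m for (e^z − 1)^m.  Both sides are compared coefficientwise at z^n y^p.
-- Right-hand side: the exponent A = (y + 1)(e^z − 1) is separable, A = (e^z − 1) ⊗ (1 + y),
-- so A^m = E m ⊗ (1 + y)^m and [z^n y^p] A^m = [z^n] E m · C(m, p).  Since E m has
-- z-order ≥ m, only m ≤ n contribute, and the m-th term of exp A is
--     (1/m!) C(m, p) [z^n] E m  =  [p ≤ m] (1/p!) (1/(m − p)!) [z^n] E m.
-- Left-hand side: 𝔹_n^{(-p)} z^n/n! · y^p/p! has coefficient [z^n] Σ_k [p ≤ k] E k/(k − p)!
-- divided by p!, and for p > n every summand with k ≤ n vanishes.  The two sums agree termwise.

open import Defs
open import Data.Nat as ℕ using (ℕ; zero; suc; _≤_; _<_; _∸_; _!; _≤ᵇ_; z≤n; s≤s)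
open import Data.Nat.Properties using (_!≢0)
import Data.Nat.Properties as ℕP
open import Data.Nat.DivMod using (m/n*n≡m)
open import Data.Nat.Combinatorics
  using (_C_; nCk≡n!/k![n-k]!; k>n⇒nCk≡0; k![n∸k]!∣n!; nCk+nC[k+1]≡[n+1]C[k+1])
open import Data.Integer as ℤ using (+_)
import Data.Integer.Properties as ℤP
open import Data.Rational using (ℚ; 0ℚ; 1ℚ; _+_; _*_; _/_; fromℚᵘ)
import Data.Rational.Properties as ℚP
import Data.Rational.Unnormalised as ℚᵘ
import Data.Rational.Unnormalised.Properties as ℚᵘP
open import Algebra.Bundles using (CommutativeMonoid)
open import Algebra.Properties.CommutativeSemigroup
  (CommutativeMonoid.commutativeSemigroup ℚP.*-1-commutativeMonoid)
  using (interchange; x∙yz≈y∙xz; x∙yz≈zx∙y; xy∙z≈y∙xz)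
open import Data.Bool using (true; false; if_then_else_)
open import Data.Empty using (⊥-elim)
open import Relation.Nullary.Reflects using (ofʸ; ofⁿ)
open import Relation.Nullary.Decidable using (yes; no)
open import Relation.Binary.PropositionalEquality
open ≡-Reasoning

fromℚᵘ-homo-+ : ∀ p q → fromℚᵘ (p ℚᵘ.+ q) ≡ fromℚᵘ p + fromℚᵘ q
fromℚᵘ-homo-+ p q = ℚP.toℚᵘ-injective (ℚᵘP.≃-trans (ℚP.toℚᵘ-fromℚᵘ (p ℚᵘ.+ q))
  (ℚᵘP.≃-sym (ℚᵘP.≃-trans (ℚP.toℚᵘ-homo-+ (fromℚᵘ p) (fromℚᵘ q))
                          (ℚᵘP.+-cong (ℚP.toℚᵘ-fromℚᵘ p) (ℚP.toℚᵘ-fromℚᵘ q)))))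

fromℚᵘ-homo-* : ∀ p q → fromℚᵘ (p ℚᵘ.* q) ≡ fromℚᵘ p * fromℚᵘ q
fromℚᵘ-homo-* p q = ℚP.toℚᵘ-injective (ℚᵘP.≃-trans (ℚP.toℚᵘ-fromℚᵘ (p ℚᵘ.* q))
  (ℚᵘP.≃-sym (ℚᵘP.≃-trans (ℚP.toℚᵘ-homo-* (fromℚᵘ p) (fromℚᵘ q))
                          (ℚᵘP.*-cong (ℚP.toℚᵘ-fromℚᵘ p) (ℚP.toℚᵘ-fromℚᵘ q)))))

-- A natural number as an unnormalised and as a normalised rational;
-- ⟦ a ⟧ is definitionally fromℚᵘ (natᵘ a), and fact n is ⟦ n ! ⟧.
natᵘ : ℕ → ℚᵘ.ℚᵘ
natᵘ a = + a ℚᵘ./ 1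

⟦_⟧ : ℕ → ℚ
⟦ a ⟧ = + a / 1

⟦⟧-+ : ∀ a b → ⟦ a ℕ.+ b ⟧ ≡ ⟦ a ⟧ + ⟦ b ⟧
⟦⟧-+ a b = trans (ℚP.fromℚᵘ-cong {natᵘ (a ℕ.+ b)} {natᵘ a ℚᵘ.+ natᵘ b} (ℚᵘ.*≡* cross))
                 (fromℚᵘ-homo-+ (natᵘ a) (natᵘ b))
  where
  cross : + (a ℕ.+ b) ℤ.* + 1 ≡ (+ a ℤ.* + 1 ℤ.+ + b ℤ.* + 1) ℤ.* + 1
  cross rewrite ℤP.*-identityʳ (+ (a ℕ.+ b)) | ℤP.*-identityʳ (+ a) | ℤP.*-identityʳ (+ b)
              | ℤP.*-identityʳ (+ a ℤ.+ + b) = ℤP.pos-+ a b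

⟦⟧-* : ∀ a b → ⟦ a ℕ.* b ⟧ ≡ ⟦ a ⟧ * ⟦ b ⟧
⟦⟧-* a b = trans (ℚP.fromℚᵘ-cong {natᵘ (a ℕ.* b)} {natᵘ a ℚᵘ.* natᵘ b} (ℚᵘ.*≡* cross))
                 (fromℚᵘ-homo-* (natᵘ a) (natᵘ b))
  where
  cross : + (a ℕ.* b) ℤ.* + 1 ≡ (+ a ℤ.* + b) ℤ.* + 1
  cross = cong (ℤ._* + 1) (ℤP.pos-* a b)

⟦⟧-inverse : ∀ d .{{_ : ℕ.NonZero d}} → ⟦ d ⟧ * (+ 1 / d) ≡ 1ℚ
⟦⟧-inverse (suc d) =
  trans (sym (fromℚᵘ-homo-* (natᵘ (suc d)) (+ 1 ℚᵘ./ suc d)))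
        (ℚP.fromℚᵘ-cong {natᵘ (suc d) ℚᵘ.* (+ 1 ℚᵘ./ suc d)} {ℚᵘ.1ℚᵘ} (ℚᵘ.*≡* cross))
  where
  cross : (+ suc d ℤ.* + 1) ℤ.* + 1 ≡ + 1 ℤ.* + (1 ℕ.* suc d)
  cross = begin
    (+ suc d ℤ.* + 1) ℤ.* + 1  ≡⟨ ℤP.*-identityʳ _ ⟩
    + suc d ℤ.* + 1            ≡⟨ ℤP.*-identityʳ _ ⟩
    + suc d                    ≡⟨ cong +_ (sym (ℕP.*-identityˡ (suc d))) ⟩
    + (1 ℕ.* suc d)            ≡⟨ sym (ℤP.*-identityˡ _) ⟩
    + 1 ℤ.* + (1 ℕ.* suc d)    ∎

fact-invFact : ∀ n → fact n * invFact n ≡ 1ℚ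
fact-invFact n = ⟦⟧-inverse (n !) {{n !≢0}}

choose-factorials : ∀ {m p} → p ≤ m → ⟦ m C p ⟧ * (fact p * fact (m ∸ p)) ≡ fact m
choose-factorials {m} {p} p≤m = begin
  ⟦ m C p ⟧ * (fact p * fact (m ∸ p))  ≡⟨ cong (⟦ m C p ⟧ *_) (sym (⟦⟧-* (p !) ((m ∸ p) !))) ⟩
  ⟦ m C p ⟧ * ⟦ p ! ℕ.* (m ∸ p) ! ⟧    ≡⟨ sym (⟦⟧-* (m C p) _) ⟩
  ⟦ (m C p) ℕ.* (p ! ℕ.* (m ∸ p) !) ⟧  ≡⟨ cong ⟦_⟧ inℕ ⟩
  fact m                               ∎
  where
  instance
    factorials≢0 : ℕ.NonZero (p ! ℕ.* (m ∸ p) !)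
    factorials≢0 = ℕP.m*n≢0 (p !) ((m ∸ p) !) {{p !≢0}} {{(m ∸ p) !≢0}}
  inℕ : (m C p) ℕ.* (p ! ℕ.* (m ∸ p) !) ≡ m !
  inℕ = trans (cong (ℕ._* (p ! ℕ.* (m ∸ p) !)) (nCk≡n!/k![n-k]! p≤m))
              (m/n*n≡m (k![n∸k]!∣n! p≤m))

invFact-choose : ∀ {m p} → p ≤ m → invFact m * ⟦ m C p ⟧ ≡ invFact p * invFact (m ∸ p)
invFact-choose {m} {p} p≤m = begin
  iM * c                             ≡⟨ sym (ℚP.*-identityʳ (iM * c)) ⟩
  (iM * c) * 1ℚ                      ≡⟨ cong ((iM * c) *_) (sym (cong₂ _*_ (fact-invFact p) (fact-invFact (m ∸ p)))) ⟩
  (iM * c) * ((P * iP) * (Q * iQ))   ≡⟨ cong ((iM * c) *_) (interchange P iP Q iQ) ⟩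
  (iM * c) * ((P * Q) * (iP * iQ))   ≡⟨ sym (ℚP.*-assoc (iM * c) (P * Q) (iP * iQ)) ⟩
  ((iM * c) * (P * Q)) * (iP * iQ)   ≡⟨ cong (_* (iP * iQ)) (ℚP.*-assoc iM c (P * Q)) ⟩
  (iM * (c * (P * Q))) * (iP * iQ)   ≡⟨ cong (λ t → (iM * t) * (iP * iQ)) (choose-factorials p≤m) ⟩
  (iM * fact m) * (iP * iQ)          ≡⟨ cong (_* (iP * iQ)) (trans (ℚP.*-comm iM (fact m)) (fact-invFact m)) ⟩
  1ℚ * (iP * iQ)                     ≡⟨ ℚP.*-identityˡ (iP * iQ) ⟩
  iP * iQ                            ∎
  where
  iM iP iQ c P Q : ℚ
  iM = invFact m
  iP = invFact p
  iQ = invFact (m ∸ p)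
  c = ⟦ m C p ⟧
  P = fact p
  Q = fact (m ∸ p)

Σ-cong : ∀ n {f g : ℕ → ℚ} → (∀ i → i ≤ n → f i ≡ g i) → Σ≤ n f ≡ Σ≤ n g
Σ-cong zero    f≗g = f≗g 0 z≤n
Σ-cong (suc n) f≗g =
  cong₂ _+_ (Σ-cong n (λ i i≤n → f≗g i (ℕP.m≤n⇒m≤1+n i≤n))) (f≗g (suc n) ℕP.≤-refl)

Σ-zero : ∀ n {f : ℕ → ℚ} → (∀ i → i ≤ n → f i ≡ 0ℚ) → Σ≤ n f ≡ 0ℚ
Σ-zero zero    f≗0 = f≗0 0 z≤n
Σ-zero (suc n) f≗0 =
  trans (cong₂ _+_ (Σ-zero n (λ i i≤n → f≗0 i (ℕP.m≤n⇒m≤1+n i≤n))) (f≗0 (suc n) ℕP.≤-refl))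
        (ℚP.+-identityʳ 0ℚ)

Σ-*ʳ : ∀ n (f : ℕ → ℚ) c → Σ≤ n f * c ≡ Σ≤ n (λ i → f i * c)
Σ-*ʳ zero    f c = refl
Σ-*ʳ (suc n) f c = trans (ℚP.*-distribʳ-+ c (Σ≤ n f) (f (suc n)))
                         (cong (_+ f (suc n) * c) (Σ-*ʳ n f c))

Σ-*ˡ : ∀ n (f : ℕ → ℚ) c → c * Σ≤ n f ≡ Σ≤ n (λ i → c * f i)
Σ-*ˡ zero    f c = refl
Σ-*ˡ (suc n) f c = trans (ℚP.*-distribˡ-+ c (Σ≤ n f) (f (suc n)))
                         (cong (_+ c * f (suc n)) (Σ-*ˡ n f c))

Σ-truncate : ∀ {k n} (f : ℕ → ℚ) → k ≤ n → (∀ i → k < i → i ≤ n → f i ≡ 0ℚ) → Σ≤ n f ≡ Σ≤ k f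
Σ-truncate {k} f k≤n = go (ℕP.≤⇒≤′ k≤n)
  where
  go : ∀ {n} → k ℕ.≤′ n → (∀ i → k < i → i ≤ n → f i ≡ 0ℚ) → Σ≤ n f ≡ Σ≤ k f
  go ℕ.≤′-refl          _    = refl
  go (ℕ.≤′-step k≤′n) tail =
    trans (cong₂ _+_ (go k≤′n (λ i k<i i≤n → tail i k<i (ℕP.m≤n⇒m≤1+n i≤n)))
                     (tail _ (s≤s (ℕP.≤′⇒≤ k≤′n)) ℕP.≤-refl))
          (ℚP.+-identityʳ _)

*PS-identityˡ : ∀ f n → (onePS *PS f) n ≡ f n
*PS-identityˡ f n = trans (Σ-truncate _ z≤n positive) (ℚP.*-identityˡ (f n))
  where
  positive : ∀ i → 0 < i → i ≤ n → onePS i * f (n ∸ i) ≡ 0ℚ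
  positive (suc i) _ _ = ℚP.*-zeroˡ (f (n ∸ suc i))

*PS-identityʳ : ∀ f n → (f *PS onePS) n ≡ f n
*PS-identityʳ f zero    = ℚP.*-identityʳ (f 0)
*PS-identityʳ f (suc n) = begin
  Σ≤ n (λ i → f i * onePS (suc n ∸ i)) + f (suc n) * onePS (n ∸ n)
    ≡⟨ cong₂ _+_ (Σ-zero n earlier) (cong (λ k → f (suc n) * onePS k) (ℕP.n∸n≡0 n)) ⟩
  0ℚ + f (suc n) * 1ℚ  ≡⟨ ℚP.+-identityˡ _ ⟩
  f (suc n) * 1ℚ       ≡⟨ ℚP.*-identityʳ _ ⟩
  f (suc n)            ∎
  where
  earlier : ∀ i → i ≤ n → f i * onePS (suc n ∸ i) ≡ 0ℚ
  earlier i i≤n rewrite ℕP.+-∸-assoc 1 i≤n = ℚP.*-zeroʳ (f i)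

powPS-order : ∀ f → f 0 ≡ 0ℚ → ∀ m n → n < m → powPS f m n ≡ 0ℚ
powPS-order f f0≡0 (suc m) n (s≤s n≤m) = Σ-zero n term
  where
  term : ∀ i → i ≤ n → f i * powPS f m (n ∸ i) ≡ 0ℚ
  term zero    _    = trans (cong (_* powPS f m n) f0≡0) (ℚP.*-zeroˡ (powPS f m n))
  term (suc i) i<n = trans (cong (f (suc i) *_) (powPS-order f f0≡0 m (n ∸ suc i) n-i<m))
                           (ℚP.*-zeroʳ (f (suc i)))
    where
    n-i<m : n ∸ suc i < m
    n-i<m = ℕP.<-≤-trans (ℕP.∸-monoʳ-< {n} {suc i} {0} (s≤s z≤n) i<n) n≤m

onePlusY : PS
onePlusY zero          = 1ℚ
onePlusY (suc zero)    = 1ℚ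
onePlusY (suc (suc _)) = 0ℚ

binomial : ∀ m p → powPS onePlusY m p ≡ ⟦ m C p ⟧
binomial zero    zero    = refl
binomial zero    (suc p) = refl
binomial (suc m) zero    = trans (ℚP.*-identityˡ _) (binomial m 0)
binomial (suc m) (suc p) = begin
  (onePlusY *PS powPS onePlusY m) (suc p)    ≡⟨ Σ-truncate _ (s≤s z≤n) beyond1 ⟩
  1ℚ * powPS onePlusY m (suc p) + 1ℚ * powPS onePlusY m p
    ≡⟨ cong₂ _+_ (trans (ℚP.*-identityˡ _) (binomial m (suc p)))
                 (trans (ℚP.*-identityˡ _) (binomial m p)) ⟩
  ⟦ m C suc p ⟧ + ⟦ m C p ⟧                  ≡⟨ ℚP.+-comm ⟦ m C suc p ⟧ ⟦ m C p ⟧ ⟩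
  ⟦ m C p ⟧ + ⟦ m C suc p ⟧                  ≡⟨ sym (⟦⟧-+ (m C p) (m C suc p)) ⟩
  ⟦ (m C p) ℕ.+ (m C suc p) ⟧                ≡⟨ cong ⟦_⟧ (nCk+nC[k+1]≡[n+1]C[k+1] m p) ⟩
  ⟦ suc m C suc p ⟧                          ∎
  where
  beyond1 : ∀ i → 1 < i → i ≤ suc p → onePlusY i * powPS onePlusY m (suc p ∸ i) ≡ 0ℚ
  beyond1 (suc zero)    (s≤s ()) _
  beyond1 (suc (suc i)) _        _ = ℚP.*-zeroˡ (powPS onePlusY m (p ∸ suc i))

_⊗_ : PS → PS → PS2
(a ⊗ b) n p = a n * b p

infix 4 _≈₂_
_≈₂_ : PS2 → PS2 → Set
F ≈₂ G = ∀ n p → F n p ≡ G n p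

*2-⊗ : ∀ {F G a b c d} → F ≈₂ a ⊗ b → G ≈₂ c ⊗ d → (F *2 G) ≈₂ (a *PS c) ⊗ (b *PS d)
*2-⊗ {F} {G} {a} {b} {c} {d} F≈ G≈ n p = begin
  Σ≤ n (λ i → Σ≤ p (λ j → F i j * G (n ∸ i) (p ∸ j)))
    ≡⟨ Σ-cong n (λ i _ → Σ-cong p (λ j _ → cong₂ _*_ (F≈ i j) (G≈ (n ∸ i) (p ∸ j)))) ⟩
  Σ≤ n (λ i → Σ≤ p (λ j → (a i * b j) * (c (n ∸ i) * d (p ∸ j))))
    ≡⟨ Σ-cong n (λ i _ → Σ-cong p (λ j _ → interchange (a i) (b j) (c (n ∸ i)) (d (p ∸ j)))) ⟩
  Σ≤ n (λ i → Σ≤ p (λ j → (a i * c (n ∸ i)) * (b j * d (p ∸ j))))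
    ≡⟨ Σ-cong n (λ i _ → sym (Σ-*ˡ p (λ j → b j * d (p ∸ j)) (a i * c (n ∸ i)))) ⟩
  Σ≤ n (λ i → (a i * c (n ∸ i)) * (b *PS d) p)
    ≡⟨ sym (Σ-*ʳ n (λ i → a i * c (n ∸ i)) ((b *PS d) p)) ⟩
  (a *PS c) n * (b *PS d) p  ∎

one2-⊗ : one2 ≈₂ onePS ⊗ onePS
one2-⊗ zero    zero    = refl
one2-⊗ zero    (suc p) = sym (ℚP.*-zeroʳ 1ℚ)
one2-⊗ (suc n) p       = sym (ℚP.*-zeroˡ (onePS p))

pow2-⊗ : ∀ {A a b} → A ≈₂ a ⊗ b → ∀ m → pow2 A m ≈₂ powPS a m ⊗ powPS b m
pow2-⊗             A≈ zero    = one2-⊗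
pow2-⊗ {A} {a} {b} A≈ (suc m) =
  *2-⊗ {a = a} {b} {powPS a m} {powPS b m} A≈ (pow2-⊗ {A} {a} {b} A≈ m)

yPlus1-⊗ : yPlus1 ≈₂ onePS ⊗ onePlusY
yPlus1-⊗ zero    zero           = refl
yPlus1-⊗ zero    (suc zero)     = refl
yPlus1-⊗ zero    (suc (suc p))  = sym (ℚP.*-zeroʳ 1ℚ)
yPlus1-⊗ (suc n) p              = sym (ℚP.*-zeroˡ (onePlusY p))

expm1₂-⊗ : expm1₂ ≈₂ expm1 ⊗ onePS
expm1₂-⊗ n zero    = sym (ℚP.*-identityʳ (expm1 n))
expm1₂-⊗ n (suc p) = sym (ℚP.*-zeroʳ (expm1 n))

exponent-⊗ : (yPlus1 *2 expm1₂) ≈₂ expm1 ⊗ onePlusY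
exponent-⊗ n p = trans (*2-⊗ {a = onePS} {onePlusY} {expm1} {onePS} yPlus1-⊗ expm1₂-⊗ n p)
                       (cong₂ _*_ (*PS-identityˡ expm1 n) (*PS-identityʳ onePlusY p))

-- [z^n] of the k-th summand (e^z − 1)^k / (k − p)!  (zero for k < p) of polyBellEGF p;
-- by definition  polyBellEGF p n = Σ≤ n (bellSummand n p).
bellSummand : ℕ → ℕ → ℕ → ℚ
bellSummand n p k = (if p ≤ᵇ k then scalePS (invFact (k ∸ p)) (powPS expm1 k) else (λ _ → 0ℚ)) n

bellSummand-vanish : ∀ n p k → k < p → bellSummand n p k ≡ 0ℚ
bellSummand-vanish n p k k<p with p ≤ᵇ k | ℕP.≤ᵇ-reflects-≤ p k
... | true  | ofʸ p≤k = ⊥-elim (ℕP.<⇒≱ k<p p≤k)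
... | false | ofⁿ _   = refl

bellSummand-active : ∀ n p k → p ≤ k → bellSummand n p k ≡ invFact (k ∸ p) * powPS expm1 k n
bellSummand-active n p k p≤k with p ≤ᵇ k | ℕP.≤ᵇ-reflects-≤ p k
... | true  | ofʸ _   = refl
... | false | ofⁿ p≰k = ⊥-elim (p≰k p≤k)

summand-match : ∀ n p m → invFact m * (powPS expm1 m n * ⟦ m C p ⟧) ≡ bellSummand n p m * invFact p
summand-match n p m with p ℕ.≤? m
... | yes p≤m = begin
  invFact m * (E * ⟦ m C p ⟧)        ≡⟨ x∙yz≈y∙xz (invFact m) E ⟦ m C p ⟧ ⟩
  E * (invFact m * ⟦ m C p ⟧)        ≡⟨ cong (E *_) (invFact-choose p≤m) ⟩
  E * (invFact p * invFact (m ∸ p))  ≡⟨ x∙yz≈zx∙y E (invFact p) (invFact (m ∸ p)) ⟩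
  (invFact (m ∸ p) * E) * invFact p  ≡⟨ cong (_* invFact p) (sym (bellSummand-active n p m p≤m)) ⟩
  bellSummand n p m * invFact p      ∎
  where
  E : ℚ
  E = powPS expm1 m n
... | no p≰m = begin
  invFact m * (powPS expm1 m n * ⟦ m C p ⟧)  ≡⟨ cong (λ c → invFact m * (powPS expm1 m n * ⟦ c ⟧)) (k>n⇒nCk≡0 (ℕP.≰⇒> p≰m)) ⟩
  invFact m * (powPS expm1 m n * 0ℚ)         ≡⟨ cong (invFact m *_) (ℚP.*-zeroʳ (powPS expm1 m n)) ⟩
  invFact m * 0ℚ                             ≡⟨ ℚP.*-zeroʳ (invFact m) ⟩
  0ℚ                                         ≡⟨ sym (ℚP.*-zeroˡ (invFact p)) ⟩
  0ℚ * invFact p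
    ≡⟨ cong (_* invFact p) (sym (bellSummand-vanish n p m (ℕP.≰⇒> p≰m))) ⟩
  bellSummand n p m * invFact p              ∎

-- Expanding exp A termwise: separate, apply the binomial theorem, drop the m > n terms
-- (E m has z-order ≥ m), and match each remaining term with a poly-Bell summand.
rhs-as-sum : ∀ n p → rhsSeries n p ≡ Σ≤ n (λ m → bellSummand n p m * invFact p)
rhs-as-sum n p = begin
  Σ≤ (n ℕ.+ p) (λ m → invFact m * pow2 (yPlus1 *2 expm1₂) m n p)
    ≡⟨ Σ-cong (n ℕ.+ p) (λ m _ → cong (invFact m *_) (separated m)) ⟩
  Σ≤ (n ℕ.+ p) term  ≡⟨ Σ-truncate term (ℕP.m≤m+n n p) (λ m n<m _ → beyond-n m n<m) ⟩
  Σ≤ n term          ≡⟨ Σ-cong n (λ m _ → summand-match n p m) ⟩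
  Σ≤ n (λ m → bellSummand n p m * invFact p) ∎
  where
  term : ℕ → ℚ
  term m = invFact m * (powPS expm1 m n * ⟦ m C p ⟧)
  separated : ∀ m → pow2 (yPlus1 *2 expm1₂) m n p ≡ powPS expm1 m n * ⟦ m C p ⟧
  separated m = trans (pow2-⊗ {a = expm1} {onePlusY} exponent-⊗ m n p)
                      (cong (powPS expm1 m n *_) (binomial m p))
  beyond-n : ∀ m → n < m → term m ≡ 0ℚ
  beyond-n m n<m = begin
    invFact m * (powPS expm1 m n * ⟦ m C p ⟧)
      ≡⟨ cong (λ e → invFact m * (e * ⟦ m C p ⟧)) (powPS-order expm1 refl m n n<m) ⟩
    invFact m * (0ℚ * ⟦ m C p ⟧)  ≡⟨ cong (invFact m *_) (ℚP.*-zeroˡ ⟦ m C p ⟧) ⟩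
    invFact m * 0ℚ               ≡⟨ ℚP.*-zeroʳ (invFact m) ⟩
    0ℚ                           ∎

-- By definition 𝔹_n^{(-p)} = n! Σ≤ n (bellSummand n p).  For p ≤ n the factors n! and 1/n!
-- cancel; for p > n the left side is 0 and every summand with m ≤ n < p vanishes.
lhs-as-sum : ∀ n p → lhsSeries n p ≡ Σ≤ n (λ m → bellSummand n p m * invFact p)
lhs-as-sum n p with p ≤ᵇ n | ℕP.≤ᵇ-reflects-≤ p n
... | true  | ofʸ _   = begin
  fact n * S * invFact n * invFact p    ≡⟨ cong (_* invFact p) (xy∙z≈y∙xz (fact n) S (invFact n)) ⟩
  S * (fact n * invFact n) * invFact p  ≡⟨ cong (λ x → S * x * invFact p) (fact-invFact n) ⟩
  S * 1ℚ * invFact p                    ≡⟨ cong (_* invFact p) (ℚP.*-identityʳ S) ⟩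
  S * invFact p                         ≡⟨ Σ-*ʳ n (bellSummand n p) (invFact p) ⟩
  Σ≤ n (λ m → bellSummand n p m * invFact p) ∎
  where
  S : ℚ
  S = Σ≤ n (bellSummand n p)
... | false | ofⁿ p≰n = sym (Σ-zero n below-p)
  where
  below-p : ∀ m → m ≤ n → bellSummand n p m * invFact p ≡ 0ℚ
  below-p m m≤n = trans (cong (_* invFact p) (bellSummand-vanish n p m (ℕP.≤-<-trans m≤n (ℕP.≰⇒> p≰n))))
                        (ℚP.*-zeroˡ (invFact p))

mainTheorem15 : (n p : ℕ) → lhsSeries n p ≡ rhsSeries n p
mainTheorem15 n p = begin
  lhsSeries n p                                ≡⟨ lhs-as-sum n p ⟩
  Σ≤ n (λ m → bellSummand n p m * invFact p)   ≡⟨ sym (rhs-as-sum n p) ⟩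
  rhsSeries n p                                ∎
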